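{- Let $n,m$ be positive integers. Write $n=am+b$ with integers $a\ge 0$ and $0\le b<m$, and set $k=\lfloor n/(a+b)\rfloor$. Then $\nu_0(\mathrm{Shift}(n,m))\ge k$.
   Context: $\mathrm{Shift}(n,m)$ is the directed Cayley graph of $\mathbb{Z}_n$ with generators $\{1,m\}$. Its vertex set is $\{0,1,\dots,n-1\}$, and it has arcs $i\to i+1 \pmod n$ and $i\to i+m \pmod n$ for every vertex $i$. Cycles are directed. For a directed graph $G$, the cycle packing number $\nu_0(G)$ is the maximum number of pairwise vertex-disjoint directed cycles in $G$. -}

module Defs where

open import Data.Nat using (ℕ; suc; _+_; _<_; NonZero)
open import Data.Nat.DivMod using (_%_)
open import Data.List using (List; []; _∷_; _++_; [_]; length)
open import Data.List.Relation.Unary.All using (All)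
open import Data.List.Relation.Unary.AllPairs using (AllPairs)
open import Data.List.Relation.Unary.Unique.Propositional using (Unique)
open import Data.List.Relation.Binary.Disjoint.Propositional using (Disjoint)
open import Data.List.Relation.Unary.Linked using (Linked)
open import Data.Product using (_×_; Σ)
open import Data.Sum using (_⊎_)
open import Data.Empty using (⊥)
open import Relation.Binary.PropositionalEquality using (_≡_)

ShiftVertex : (n : ℕ) → ℕ → Set
ShiftVertex n i = i < n

ShiftArc : (n m : ℕ) → .{{NonZero n}} → ℕ → ℕ → Set
ShiftArc n m i j = (suc i) % n ≡ j ⊎ (i + m) % n ≡ j

-- A directed cycle, given as the list of its vertices v₀ v₁ … v_{l-1} (l ≥ 1),
-- pairwise distinct, with arcs v₀→v₁→…→v_{l-1}→v₀.
-- (l = 1 is a loop, l = 2 a digon.)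
IsCycle : (n m : ℕ) → .{{NonZero n}} → List ℕ → Set
IsCycle n m [] = ⊥
IsCycle n m (v ∷ vs) =
  All (ShiftVertex n) (v ∷ vs) ×
  Unique (v ∷ vs) ×
  Linked (ShiftArc n m) ((v ∷ vs) ++ [ v ])

IsCyclePacking : (n m : ℕ) → .{{NonZero n}} → List (List ℕ) → Set
IsCyclePacking n m cs = All (IsCycle n m) cs × AllPairs Disjoint cs

ν₀≥ : (n m : ℕ) → .{{NonZero n}} → ℕ → Set
ν₀≥ n m k = Σ (List (List ℕ)) λ cs → IsCyclePacking n m cs × length cs ≡ k

module Submission where

-- Let S = a + b, so that n = a·m + b.  Cycle number j (for j < k) is obtained by
-- walking in the infinite "lifted" graph on ℕ (arcs v → v + 1 and v → v + m)
-- from the position j·(m − 1), driven by a state x ∈ [0, S): if x < a take a long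
-- arc (+m) and set x := x + b, otherwise take a short arc (+1) and set x := x − a.
--
-- * Starting from state 0, any S moves consist of exactly a long and b short ones
--   ('balance'), so the lifted walk ends at its start plus a·m + b = n ('closes').
--   Positions increase strictly, so all S positions lie in a window of length n;
--   reduced mod n they form a directed cycle of Shift(n,m) ('projected-cycle').
-- * Along the walk of cycle j the quantity a·v + j·S + x stays divisible by n
--   ('trail-classes').  Hence the vertices u of cycle j satisfy a·u + c ≡ 0 (mod n)
--   for an offset c ∈ [j·S, (j+1)·S), and since k·S ≤ n the offsets of different
--   cycles are distinct numbers below n; two congruent vertices would give two
--   multiples of n less than n apart ('separated-classes').  So the k cycles are
--   pairwise disjoint.

open import Defs
open import Data.Nat
  using (ℕ; zero; suc; _+_; _*_; _∸_; _≤_; _<_; NonZero; pred; z≤n; s≤s⁻¹; z<s; >-nonZero; >-nonZero⁻¹; _<?_)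
open import Data.Nat.Properties
open import Data.Nat.DivMod using (_%_; _/_; m≡m%n+[m/n]*n; m%n<n; m%n%n≡m%n; [m+n]%n≡m%n; %-distribˡ-+; %-distribˡ-*)
open import Data.Nat.Divisibility
  using (_∣_; divides; ∣⇒≤; ∣m+n∣m⇒∣n; ∣m∣n⇒∣m+n; n∣m*n; ∣-refl; m%n≡0⇒n∣m; n∣m⇒m%n≡0)
open import Data.Nat.Tactic.RingSolver using (solve-∀)
open import Data.List using (List; []; _∷_; _++_; [_]; map; applyUpTo)
open import Data.List.Properties using (map-++; length-applyUpTo)
open import Data.List.Relation.Unary.All as All using (All; []; _∷_)
import Data.List.Relation.Unary.All.Properties as All
open import Data.List.Relation.Unary.AllPairs using (AllPairs; []; _∷_)
import Data.List.Relation.Unary.AllPairs.Properties as AllPairs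
open import Data.List.Relation.Unary.Unique.Propositional using (Unique)
open import Data.List.Relation.Unary.Linked as Linked using (Linked; []; [-]; _∷_)
import Data.List.Relation.Unary.Linked.Properties as Linked
open import Data.List.Relation.Binary.Disjoint.Propositional using (Disjoint)
open import Data.List.Membership.Propositional.Properties using (∈-map⁻)
open import Data.Product using (_×_; _,_; proj₁; proj₂; ∃-syntax)
open import Data.Empty using (⊥-elim)
open import Data.Sum using (_⊎_; inj₁; inj₂)
open import Relation.Nullary using (Dec; yes; no; ¬_)
open import Relation.Binary.PropositionalEquality
  using (_≡_; _≢_; refl; sym; trans; cong; cong₂; subst; module ≡-Reasoning)

LiftedArc : ℕ → ℕ → ℕ → Set
LiftedArc m v w = suc v ≡ w ⊎ v + m ≡ w

arc-increasing : ∀ {m v w} → 0 < m → LiftedArc m v w → v < w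
arc-increasing _   (inj₁ refl) = n<1+n _
arc-increasing m>0 (inj₂ refl) = m<m+n _ m>0

all-before-last : ∀ {R : ℕ → ℕ → Set} {e} xs → AllPairs R (xs ++ [ e ]) → All (λ x → R x e) xs
all-before-last []       _               = []
all-before-last (x ∷ xs) (x~rest ∷ rest) = All.head (All.++⁻ʳ xs x~rest) ∷ all-before-last xs rest

module Residues (n : ℕ) .{{_ : NonZero n}} where

  residue-+ˡ : ∀ c {x y} → x % n ≡ y % n → (c + x) % n ≡ (c + y) % n
  residue-+ˡ c {x} {y} eq =
    trans (%-distribˡ-+ c x n) (trans (cong (λ r → (c % n + r) % n) eq) (sym (%-distribˡ-+ c y n)))

  residue-+ʳ : ∀ c {x y} → x % n ≡ y % n → (x + c) % n ≡ (y + c) % n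
  residue-+ʳ c {x} {y} eq =
    trans (%-distribˡ-+ x c n) (trans (cong (λ r → (r + c % n) % n) eq) (sym (%-distribˡ-+ y c n)))

  residue-*ˡ : ∀ c {x y} → x % n ≡ y % n → (c * x) % n ≡ (c * y) % n
  residue-*ˡ c {x} {y} eq =
    trans (%-distribˡ-* c x n) (trans (cong (λ r → (c % n * r) % n) eq) (sym (%-distribˡ-* c y n)))

  equal-residues⇒∣ : ∀ x d → x % n ≡ (x + d) % n → n ∣ d
  equal-residues⇒∣ x d eq = ∣m+n∣m⇒∣n (divides ((x + d) / n) quotients) (n∣m*n (x / n))
    where
    open ≡-Reasoning
    quotients : (x / n) * n + d ≡ ((x + d) / n) * n
    quotients = +-cancelˡ-≡ (x % n) _ _ (begin
      x % n + ((x / n) * n + d)   ≡⟨ sym (+-assoc (x % n) _ d) ⟩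
      x % n + (x / n) * n + d     ≡⟨ cong (_+ d) (sym (m≡m%n+[m/n]*n x n)) ⟩
      x + d                       ≡⟨ m≡m%n+[m/n]*n (x + d) n ⟩
      (x + d) % n + ((x + d) / n) * n ≡⟨ cong (_+ ((x + d) / n) * n) (sym eq) ⟩
      x % n + ((x + d) / n) * n   ∎)

  small-non-multiple : ∀ {d} → 0 < d → d < n → ¬ n ∣ d
  small-non-multiple {suc _} _ d<n n∣d = <⇒≱ d<n (∣⇒≤ n∣d)

  residues-differ : ∀ {v w} → v < w → w < v + n → v % n ≢ w % n
  residues-differ {v} {w} v<w w<v+n eq =
    small-non-multiple (m<n⇒0<n∸m v<w) (m<n+o⇒m∸n<o w v w<v+n)
      (equal-residues⇒∣ v (w ∸ v) (trans eq (cong (_% n) (sym (m+[n∸m]≡n (<⇒≤ v<w))))))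

  ∣-respects-residue : ∀ a c {x y} → x % n ≡ y % n → n ∣ a * x + c → n ∣ a * y + c
  ∣-respects-residue a c {x} {y} eq n∣ax+c =
    m%n≡0⇒n∣m _ n (trans (residue-+ʳ c (residue-*ˡ a (sym eq))) (n∣m⇒m%n≡0 _ n n∣ax+c))

  separated-classes : ∀ a {c c' w w'} → c < c' → c' < n →
                      n ∣ a * w + c → n ∣ a * w' + c' → w % n ≢ w' % n
  separated-classes a {c} {c'} {w} {w'} c<c' c'<n n∣aw+c n∣aw'+c' eq =
    residues-differ (+-monoʳ-< (a * w') c<c') close
      (trans (n∣m⇒m%n≡0 _ n (∣-respects-residue a c eq n∣aw+c)) (sym (n∣m⇒m%n≡0 _ n n∣aw'+c')))
    where
    close : a * w' + c' < a * w' + c + n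
    close = subst (a * w' + c' <_) (sym (+-assoc (a * w') c n))
              (+-monoʳ-< (a * w') (<-≤-trans c'<n (m≤n+m n c)))

  window-unique : ∀ {v} xs → All (v ≤_) xs → AllPairs _<_ (xs ++ [ v + n ]) → Unique (map (_% n) xs)
  window-unique []       _              _               = []
  window-unique {v} (w ∷ xs) (v≤w ∷ v≤xs) (w<rest ∷ increasing) =
    All.map⁺ (All.zipWith differ (All.++⁻ˡ xs w<rest , all-before-last xs increasing))
    ∷ window-unique xs v≤xs increasing
    where
    differ : ∀ {u} → w < u × u < v + n → w % n ≢ u % n
    differ (w<u , u<v+n) = residues-differ w<u (<-≤-trans u<v+n (+-monoˡ-≤ n v≤w))

  project-arc : ∀ {m v w} → LiftedArc m v w → ShiftArc n m (v % n) (w % n)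
  project-arc {m} {v} (inj₁ refl) = inj₁ (residue-+ˡ 1 (m%n%n≡m%n v n))
  project-arc {m} {v} (inj₂ refl) = inj₂ (residue-+ʳ m (m%n%n≡m%n v n))

  projected-cycle : ∀ {m} → 0 < m → ∀ v ws → Linked (LiftedArc m) (v ∷ ws ++ [ v + n ]) →
                    IsCycle n m (map (_% n) (v ∷ ws))
  projected-cycle {m} m>0 v ws path = vertices , unique , closed
    where
    increasing : AllPairs _<_ (v ∷ ws ++ [ v + n ])
    increasing = Linked.Linked⇒AllPairs <-trans (Linked.map (arc-increasing m>0) path)

    vertices : All (ShiftVertex n) (map (_% n) (v ∷ ws))
    vertices = All.map⁺ (All.universal (λ w → m%n<n w n) (v ∷ ws))

    unique : Unique (map (_% n) (v ∷ ws))
    unique with increasing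
    ... | v<rest ∷ _ = window-unique (v ∷ ws) (≤-refl ∷ All.map <⇒≤ (All.++⁻ˡ ws v<rest)) increasing

    projection : map (_% n) (v ∷ ws ++ [ v + n ]) ≡ map (_% n) (v ∷ ws) ++ [ v % n ]
    projection = cong (v % n ∷_) (trans (map-++ (_% n) ws [ v + n ])
                   (cong (λ r → map (_% n) ws ++ [ r ]) ([m+n]%n≡m%n v n)))

    closed : Linked (ShiftArc n m) (map (_% n) (v ∷ ws) ++ [ v % n ])
    closed = subst (Linked (ShiftArc n m)) projection (Linked.map⁺ (Linked.map project-arc path))

quotient-unique : ∀ {X Q B S} → X < S → X + Q * S ≡ B * S → Q ≡ B
quotient-unique {X} {Q} {B} {S} X<S eq = ≤-antisym Q≤B (s≤s⁻¹ B<1+Q)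
  where
  instance
    S≢0 : NonZero S
    S≢0 = >-nonZero (≤-<-trans z≤n X<S)
  Q≤B : Q ≤ B
  Q≤B = *-cancelʳ-≤ Q B S (subst (Q * S ≤_) eq (m≤n+m (Q * S) X))
  B<1+Q : B < suc Q
  B<1+Q = *-cancelʳ-< S B (suc Q) (subst (_< S + Q * S) eq (+-monoˡ-< (Q * S) X<S))

-- If P + Q = a + b moves change a state from 0 to X < a + b, where a long move adds b
-- and a short move subtracts a (X + Q·a = P·b), then P = a and Q = b.
balance : ∀ {a b P Q X} → P + Q ≡ a + b → X + Q * a ≡ P * b → X < a + b → P ≡ a × Q ≡ b
balance {a} {b} {P} {Q} {X} moves state X<S = +-cancelʳ-≡ b P a (subst (λ q → P + q ≡ a + b) Q≡b moves) , Q≡b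
  where
  open ≡-Reasoning
  blocks : X + Q * (a + b) ≡ b * (a + b)
  blocks = begin
    X + Q * (a + b)     ≡⟨ cong (X +_) (*-distribˡ-+ Q a b) ⟩
    X + (Q * a + Q * b) ≡⟨ sym (+-assoc X (Q * a) (Q * b)) ⟩
    X + Q * a + Q * b   ≡⟨ cong (_+ Q * b) state ⟩
    P * b + Q * b       ≡⟨ sym (*-distribʳ-+ b P Q) ⟩
    (P + Q) * b         ≡⟨ cong (_* b) moves ⟩
    (a + b) * b         ≡⟨ *-comm (a + b) b ⟩
    b * (a + b)         ∎
  Q≡b : Q ≡ b
  Q≡b = quotient-unique X<S blocks

module Walk (m a b : ℕ) where

  nextState : ∀ x → Dec (x < a) → ℕ
  nextState x (yes _) = x + b
  nextState x (no _)  = x ∸ a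

  nextPos : ∀ {x} → ℕ → Dec (x < a) → ℕ
  nextPos v (yes _) = v + m
  nextPos v (no _)  = suc v

  trail : ℕ → ℕ → ℕ → List ℕ
  trail zero    x v = []
  trail (suc f) x v = v ∷ trail f (nextState x (x <? a)) (nextPos v (x <? a))

  endPos : ℕ → ℕ → ℕ → ℕ
  endPos zero    x v = v
  endPos (suc f) x v = endPos f (nextState x (x <? a)) (nextPos v (x <? a))

  endState : ℕ → ℕ → ℕ → ℕ
  endState zero    x v = x
  endState (suc f) x v = endState f (nextState x (x <? a)) (nextPos v (x <? a))

  trail-snoc : ∀ f x v → trail (suc f) x v ≡ trail f x v ++ [ endPos f x v ]
  trail-snoc zero    x v = refl
  trail-snoc (suc f) x v = cong (v ∷_) (trail-snoc f (nextState x (x <? a)) (nextPos v (x <? a)))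

  move-arc : ∀ {x} v (d : Dec (x < a)) → LiftedArc m v (nextPos v d)
  move-arc v (yes _) = inj₂ refl
  move-arc v (no _)  = inj₁ refl

  trail-linked : ∀ f x v → Linked (LiftedArc m) (trail f x v)
  trail-linked zero          x v = []
  trail-linked (suc zero)    x v = [-]
  trail-linked (suc (suc f)) x v =
    move-arc v (x <? a) ∷ trail-linked (suc f) (nextState x (x <? a)) (nextPos v (x <? a))

  move-bounded : ∀ x (d : Dec (x < a)) → x < a + b → nextState x d < a + b
  move-bounded x (yes x<a) _     = +-monoˡ-< b x<a
  move-bounded x (no _)    x<a+b = ≤-<-trans (m∸n≤m x a) x<a+b

  endState-bounded : ∀ f x v → x < a + b → endState f x v < a + b
  endState-bounded zero    x v x<S = x<S
  endState-bounded (suc f) x v x<S =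
    endState-bounded f (nextState x (x <? a)) (nextPos v (x <? a)) (move-bounded x (x <? a) x<S)

  record Tally (f x v e s : ℕ) : Set where
    field
      long short : ℕ
      moves      : long + short ≡ f
      position   : e ≡ v + (long * m + short)
      state      : s + short * a ≡ x + long * b

  move-tally : ∀ {f e s} x v (d : Dec (x < a)) →
               Tally f (nextState x d) (nextPos v d) e s → Tally (suc f) x v e s
  move-tally x v (yes _) record { long = P ; short = Q ; moves = moves ; position = position ; state = state } =
    record { long = suc P ; short = Q ; moves = cong suc moves
           ; position = trans position (long-position v P Q m)
           ; state = trans state (+-assoc x b (P * b)) }
    where
    long-position : ∀ v P Q m → v + m + (P * m + Q) ≡ v + (suc P * m + Q)
    long-position = solve-∀
  move-tally {s = s} x v (no x≮a) record { long = P ; short = Q ; moves = moves ; position = position ; state = state } =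
    record { long = P ; short = suc Q ; moves = trans (+-suc P Q) (cong suc moves)
           ; position = trans position (short-position v P Q m)
           ; state = short-state }
    where
    open ≡-Reasoning
    short-position : ∀ v P Q m → suc v + (P * m + Q) ≡ v + (P * m + suc Q)
    short-position = solve-∀
    regroup : ∀ s a Q → s + suc Q * a ≡ a + (s + Q * a)
    regroup = solve-∀
    short-state : s + suc Q * a ≡ x + P * b
    short-state = begin
      s + suc Q * a        ≡⟨ regroup s a Q ⟩
      a + (s + Q * a)      ≡⟨ cong (a +_) state ⟩
      a + (x ∸ a + P * b)  ≡⟨ sym (+-assoc a (x ∸ a) (P * b)) ⟩
      a + (x ∸ a) + P * b  ≡⟨ cong (_+ P * b) (m+[n∸m]≡n (≮⇒≥ x≮a)) ⟩
      x + P * b            ∎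

  tally : ∀ f x v → Tally f x v (endPos f x v) (endState f x v)
  tally zero    x v = record { long = 0 ; short = 0 ; moves = refl ; position = sym (+-identityʳ v) ; state = refl }
  tally (suc f) x v = move-tally x v (x <? a) (tally f (nextState x (x <? a)) (nextPos v (x <? a)))

  closes : 0 < a + b → ∀ v → endPos (a + b) 0 v ≡ v + (a * m + b)
  closes S>0 v = trans position (cong₂ (λ P Q → v + (P * m + Q)) long≡a short≡b)
    where
    open Tally (tally (a + b) 0 v)
    counts : long ≡ a × short ≡ b
    counts = balance moves state (endState-bounded (a + b) 0 v S>0)
    long≡a : long ≡ a
    long≡a = proj₁ counts
    short≡b : short ≡ b
    short≡b = proj₂ counts

  InClass : ℕ → ℕ → ℕ → Set
  InClass n J w = ∃[ y ] y < a + b × n ∣ a * w + (J + y)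

  move-preserves : ∀ {n} → n ∣ a * m + b → ∀ J x v (d : Dec (x < a)) →
                   n ∣ a * v + (J + x) → n ∣ a * nextPos v d + (J + nextState x d)
  move-preserves {n} n∣am+b J x v (yes _) n∣ =
    subst (n ∣_) (sym (long-move a v m J x b)) (∣m∣n⇒∣m+n n∣ n∣am+b)
    where
    long-move : ∀ a v m J x b → a * (v + m) + (J + (x + b)) ≡ a * v + (J + x) + (a * m + b)
    long-move = solve-∀
  move-preserves {n} n∣am+b J x v (no x≮a) n∣ =
    subst (n ∣_) (sym (trans (short-move a v J (x ∸ a)) (cong (λ t → a * v + (J + t)) (m+[n∸m]≡n (≮⇒≥ x≮a))))) n∣
    where
    short-move : ∀ a v J t → a * suc v + (J + t) ≡ a * v + (J + (a + t))
    short-move = solve-∀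

  trail-classes : ∀ {n} → n ∣ a * m + b → ∀ J f x v → x < a + b → n ∣ a * v + (J + x) →
                  All (InClass n J) (trail f x v)
  trail-classes n∣am+b J zero    x v _   _  = []
  trail-classes n∣am+b J (suc f) x v x<S n∣ =
    (x , x<S , n∣) ∷ trail-classes n∣am+b J f (nextState x (x <? a)) (nextPos v (x <? a))
                       (move-bounded x (x <? a) x<S) (move-preserves n∣am+b J x v (x <? a) n∣)

module Packing (n m a b k L : ℕ) .{{_ : NonZero n}} .{{_ : NonZero m}}
               (n≡am+b : n ≡ a * m + b) (S≡1+L : a + b ≡ suc L) (kS≤n : k * (a + b) ≤ n) where
  open Residues n
  open Walk m a b

  S : ℕ
  S = a + b

  S>0 : 0 < S
  S>0 = subst (0 <_) (sym S≡1+L) z<s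

  start : ℕ → ℕ
  start j = j * pred m

  -- The start of cycle j lies in class j·S with offset 0, since a(m−1) + S = n.
  start-in-class : ∀ j → n ∣ a * start j + (j * S + 0)
  start-in-class j = subst (n ∣_) (sym (trans (start-identity a j (pred m) b) (cong (j *_) n-identity))) (n∣m*n j)
    where
    start-identity : ∀ a j p b → a * (j * p) + (j * (a + b) + 0) ≡ j * (a * suc p + b)
    start-identity = solve-∀
    n-identity : a * suc (pred m) + b ≡ n
    n-identity = trans (cong (λ q → a * q + b) (suc-pred m)) (sym n≡am+b)

  cycle : ℕ → List ℕ
  cycle j = map (_% n) (trail (suc L) 0 (start j))

  cycle-isCycle : ∀ j → IsCycle n m (cycle j)
  cycle-isCycle j = projected-cycle (>-nonZero⁻¹ m) v _ path
    where
    v : ℕ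
    v = start j
    closing : endPos (suc L) 0 v ≡ v + n
    closing = trans (cong (λ f → endPos f 0 v) (sym S≡1+L))
                (trans (closes S>0 v) (cong (v +_) (sym n≡am+b)))
    path : Linked (LiftedArc m) (trail (suc L) 0 v ++ [ v + n ])
    path = subst (λ e → Linked (LiftedArc m) (trail (suc L) 0 v ++ [ e ])) closing
             (subst (Linked (LiftedArc m)) (trail-snoc (suc L) 0 v) (trail-linked (suc (suc L)) 0 v))

  cycle-classes : ∀ j → All (InClass n (j * S)) (trail (suc L) 0 (start j))
  cycle-classes j = trail-classes (subst (n ∣_) n≡am+b (∣-refl {n})) (j * S) (suc L) 0 (start j) S>0 (start-in-class j)

  offset-below : ∀ i {y} → y < S → i * S + y < suc i * S
  offset-below i {y} y<S = subst (i * S + y <_) (+-comm (i * S) S) (+-monoʳ-< (i * S) y<S)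

  cycles-disjoint : ∀ {i j} → i < j → j < k → Disjoint (cycle i) (cycle j)
  cycles-disjoint {i} {j} i<j j<k (u∈i , u∈j) with ∈-map⁻ (_% n) u∈i | ∈-map⁻ (_% n) u∈j
  ... | w , w∈ , refl | w' , w'∈ , u≡w' with All.lookup (cycle-classes i) w∈ | All.lookup (cycle-classes j) w'∈
  ... | y , y<S , n∣w | y' , y'<S , n∣w' = separated-classes a c<c' c'<n n∣w n∣w' u≡w'
    where
    c<c' : i * S + y < j * S + y'
    c<c' = <-≤-trans (offset-below i y<S) (≤-trans (*-monoˡ-≤ S i<j) (m≤m+n (j * S) y'))
    c'<n : j * S + y' < n
    c'<n = <-≤-trans (offset-below j y'<S) (≤-trans (*-monoˡ-≤ S j<k) kS≤n)

block-positive : ∀ {n k S} → n < suc k * S → ∃[ L ] S ≡ suc L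
block-positive {n} {k} {zero}  n<0 = ⊥-elim (n≮0 (subst (n <_) (*-zeroʳ (suc k)) n<0))
block-positive {S = suc L}     _   = L , refl

-- The cycles 0, …, k − 1 form the packing.
theorem6 : (n m : ℕ) → .{{_ : NonZero n}} → .{{_ : NonZero m}} →
    (a b : ℕ) → n ≡ a * m + b → b < m →
    (k : ℕ) → k * (a + b) ≤ n → n < suc k * (a + b) →
    ν₀≥ n m k
theorem6 n m a b n≡am+b _ k kS≤n n<[k+1]S with block-positive {n} {k} n<[k+1]S
... | L , S≡1+L =
  applyUpTo cycle k ,
  (All.applyUpTo⁺₂ cycle k cycle-isCycle , AllPairs.applyUpTo⁺₁ cycle k cycles-disjoint) ,
  length-applyUpTo cycle k
  where open Packing n m a b k L n≡am+b S≡1+L kS≤n
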